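{- For every integer $m\ge 3$, \[ \gamma_{oiR}(P_{3}\Box C_{m})=\begin{cases}2m, & m\equiv 0 \pmod 2,\\ 2m+1, & m\equiv 1 \pmod 2.\end{cases} \]
   Context: All graphs are simple and undirected. $P_n$ denotes the path on $n$ vertices and $C_m$ the cycle on $m$ vertices; $P_n\Box C_m$ is their Cartesian product, with vertex set $\{v_{i,j}: 0\le i\le n-1,\ 0\le j\le m-1\}$, where $v_{i,j}$ and $v_{i',j'}$ are adjacent iff either $i=i'$ and $j'\equiv j\pm1 \pmod m$, or $j=j'$ and $|i-i'|=1$. For a graph $G=(V,E)$, an outer independent Roman dominating function (OIRDF) is a function $f:V\to\{0,1,2\}$ such that every vertex $u$ with $f(u)=0$ has a neighbour $v$ with $f(v)=2$, and the set $V_0=\{u\in V: f(u)=0\}$ is an independent set. The weight of $f$ is $w(f)=\sum_{v\in V}f(v)$, and $\gamma_{oiR}(G)$ is the minimum weight of an OIRDF of $G$. -}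

module Defs where

open import Data.Nat using (ℕ; _+_; _*_; _≤_; _%_)
import Data.Nat as ℕ
open import Data.Fin using (Fin; toℕ; zero; suc)
open import Data.Product using (_×_; _,_; Σ; ∃)
open import Data.Sum using (_⊎_)
open import Data.Empty using (⊥)
open import Relation.Binary.PropositionalEquality using (_≡_)

record Graph : Set₁ where
  field
    N   : ℕ
    Adj : Fin N → Fin N → Set

sumFin : (n : ℕ) → (Fin n → ℕ) → ℕ
sumFin ℕ.zero f = 0
sumFin (ℕ.suc n) f = f zero + sumFin n (λ i → f (suc i))

Label : Set
Label = Fin 3

val : Label → ℕ
val = toℕ

record IsOIRDF (G : Graph) (f : Fin (Graph.N G) → Label) : Set where
  open Graph G
  field
    dominated   : ∀ u → val (f u) ≡ 0 → ∃ λ v → Adj u v × val (f v) ≡ 2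
    independent : ∀ u v → val (f u) ≡ 0 → val (f v) ≡ 0 → Adj u v → ⊥

weight : (G : Graph) → (Fin (Graph.N G) → Label) → ℕ
weight G f = sumFin (Graph.N G) (λ v → val (f v))

γoiR≡ : Graph → ℕ → Set
γoiR≡ G k =
  (Σ (Fin (Graph.N G) → Label) λ f → IsOIRDF G f × weight G f ≡ k)
  × (∀ f → IsOIRDF G f → k ≤ weight G f)

-- Cartesian product P_n □ C_m.  Vertex v_{i,j} is the element
-- combine i j = i * m + j of Fin (n * m); remQuot decodes it back to (i , j).
open import Data.Fin using (combine; remQuot)

CycAdj : (m : ℕ) → Fin m → Fin m → Set
CycAdj m j j' =
  (toℕ j + 1 ≡ toℕ j') ⊎ (toℕ j' + 1 ≡ toℕ j)
  ⊎ (toℕ j + 1 ≡ m × toℕ j' ≡ 0) ⊎ (toℕ j' + 1 ≡ m × toℕ j ≡ 0)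

PathAdj : (n : ℕ) → Fin n → Fin n → Set
PathAdj n i i' = (toℕ i + 1 ≡ toℕ i') ⊎ (toℕ i' + 1 ≡ toℕ i)

PCAdj : (n m : ℕ) → Fin n × Fin m → Fin n × Fin m → Set
PCAdj n m (i , j) (i' , j') = (i ≡ i' × CycAdj m j j') ⊎ (j ≡ j' × PathAdj n i i')

P□C : ℕ → ℕ → Graph
P□C n m = record
  { N   = n * m
  ; Adj = λ u v → PCAdj n m (remQuot m u) (remQuot m v)
  }

module Submission where

-- Cut P₃ □ Cₘ into its m columns, each written top to bottom as a word over
-- {0, 1, 2}. Being an OIRDF is a condition on each triple of consecutive
-- columns, so a lower bound on the weight can be proved by discharging
-- around the cycle of columns. A column of weight w whose middle cell holds
-- z ∈ {0, 1} zeros starts with charge 8w + 4z. A column 0x0 receives 1 from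
-- each neighbour, and a 010 receives 4 more for every 2 in the top and
-- bottom cells of that neighbour; a column 011 (resp. 110) receives 2 from a
-- neighbour whose top (resp. bottom) cell is 2. Checking all triples of
-- columns shows that every column keeps at least 18, so 18m ≤ 8 w(f) + 4Z,
-- where Z counts the zeros of the middle row. These zeros are independent
-- in the middle copy of Cₘ, so 2Z ≤ m, with strict inequality for odd m;
-- hence w(f) ≥ 2m, and w(f) ≥ 2m + 1 for odd m. The columns 101 and 020
-- alternating around the cycle, with a single column 111 inserted when m is
-- odd, attain these bounds.

open import Defs
open import Data.Nat using (ℕ; _≤_; _+_; _*_; _%_)
open import Relation.Binary.PropositionalEquality using (_≡_)
open import Data.Product using (_×_)

open import Data.Nat using (zero; suc; pred; _<_; _≤?_; NonZero; z≤n; s≤s)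
import Data.Nat as ℕ
open import Data.Nat.Properties
open import Data.Nat.DivMod using (_mod_; m%n<n; m<n⇒m%n≡m; n%n≡0; [m+n]%n≡m%n; %-distribˡ-+; m%n%n≡m%n; m*n%n≡0)
open import Data.Nat.Tactic.RingSolver using (solve-∀)
open import Data.Fin using (Fin; zero; suc; toℕ; combine; remQuot; _↑ˡ_; _↑ʳ_)
open import Data.Fin.Patterns using (0F; 1F; 2F)
open import Data.Fin.Properties using (toℕ-injective; toℕ-fromℕ<; toℕ<n; remQuot-combine; combine-remQuot; all?)
open import Data.Product using (Σ; _,_; proj₁; proj₂; uncurry)
open import Data.Sum using (_⊎_; inj₁; inj₂)
open import Data.Empty using (⊥-elim)
open import Data.List using (List; []; _∷_; map; filter; allFin)
open import Data.List.Relation.Unary.All as All using (All; _∷_)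
open import Data.List.Relation.Unary.Any as Any using (Any; here; there)
import Data.List.Relation.Unary.All.Properties as All
import Data.List.Relation.Unary.Any.Properties as Any
open import Data.List.Membership.Propositional using (_∈_; find; lose)
open import Data.List.Membership.Propositional.Properties using (∈-map⁺; ∈-map⁻; ∈-filter⁺; ∈-filter⁻; ∈-allFin)
open import Function using (_⇔_; mk⇔; Equivalence; id; _∘_)
open import Relation.Nullary using (Dec; ¬?; _×-dec_; _→-dec_; _⊎-dec_)
open import Relation.Nullary.Decidable using (from-yes; map′)
open import Relation.Binary.PropositionalEquality using (_≢_; refl; sym; trans; cong; cong₂; subst; subst₂; module ≡-Reasoning)
open import Algebra.Properties.CommutativeMonoid.Sum +-0-commutativeMonoid
  using (sum; sum-syntax; sum-cong-≗; ∑-distrib-+; ∑-comm)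
open import Algebra.Properties.Semiring.Sum +-*-semiring using (*-distribˡ-sum)

open Equivalence using (to; from)

subst₃ : ∀ {A B C : Set} (P : A → B → C → Set) {x x' y y' z z'} →
         x ≡ x' → y ≡ y' → z ≡ z' → P x y z → P x' y' z'
subst₃ P refl refl refl p = p

sumFin≡sum : ∀ n (f : Fin n → ℕ) → sumFin n f ≡ sum f
sumFin≡sum zero    f = refl
sumFin≡sum (suc n) f = cong (f zero +_) (sumFin≡sum n (λ i → f (suc i)))

sum-↑ : ∀ m k (g : Fin (m + k) → ℕ) →
        sum g ≡ ∑[ i < m ] g (i ↑ˡ k) + ∑[ j < k ] g (m ↑ʳ j)
sum-↑ zero    k g = refl
sum-↑ (suc m) k g = trans (cong (g zero +_) (sum-↑ m k (λ i → g (suc i))))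
                          (sym (+-assoc (g zero) _ _))

sum-combine : ∀ n m (g : Fin (n * m) → ℕ) →
              sum g ≡ ∑[ i < n ] ∑[ j < m ] g (combine i j)
sum-combine zero    m g = refl
sum-combine (suc n) m g =
  trans (sum-↑ m (n * m) g)
        (cong (∑[ j < m ] g (combine {suc n} zero j) +_) (sum-combine n m (λ v → g (m ↑ʳ v))))

sum-mono-≤ : ∀ {n} {f g : Fin n → ℕ} → (∀ i → f i ≤ g i) → sum f ≤ sum g
sum-mono-≤ {zero}  f≤g = z≤n
sum-mono-≤ {suc n} f≤g = +-mono-≤ (f≤g zero) (sum-mono-≤ (λ i → f≤g (suc i)))

sum-const : ∀ n c → ∑[ i < n ] c ≡ n * c
sum-const zero    c = refl
sum-const (suc n) c = cong (c +_) (sum-const n c)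

sum-rotate : ∀ n (g : ℕ → ℕ) → g n ≡ g 0 →
             ∑[ i < n ] g (suc (toℕ i)) ≡ ∑[ i < n ] g (toℕ i)
sum-rotate n g gn≡g0 = +-cancelʳ-≡ (g 0) _ _ (begin
  ∑[ i < n ] g (suc (toℕ i)) + g 0   ≡⟨ +-comm _ (g 0) ⟩
  ∑[ i < suc n ] g (toℕ i)           ≡⟨ sum-snoc n g ⟩
  ∑[ i < n ] g (toℕ i) + g n         ≡⟨ cong (∑[ i < n ] g (toℕ i) +_) gn≡g0 ⟩
  ∑[ i < n ] g (toℕ i) + g 0         ∎)
  where
  open ≡-Reasoning
  sum-snoc : ∀ n (g : ℕ → ℕ) → ∑[ i < suc n ] g (toℕ i) ≡ ∑[ i < n ] g (toℕ i) + g n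
  sum-snoc zero    g = +-comm (g 0) 0
  sum-snoc (suc n) g = trans (cong (g 0 +_) (sum-snoc n (λ k → g (suc k)))) (sym (+-assoc (g 0) _ _))

-- Discharging along a cycle

Periodic : {A : Set} → ℕ → (ℕ → A) → Set
Periodic n c = ∀ k → c (k + n) ≡ c k

module Discharging {A : Set} (demand charge : A → ℕ) (send : A → A → ℕ) where

  Balanced : A → A → A → Set
  Balanced a b c = demand b + (send b a + send b c) ≤ charge b + (send a b + send c b)

  discharging : ∀ n (c : ℕ → A) → Periodic n c →
                (∀ k → Balanced (c k) (c (suc k)) (c (suc (suc k)))) →
                ∑[ i < n ] demand (c (toℕ i)) ≤ ∑[ i < n ] charge (c (toℕ i))
  -- Each transfer is spent by one element and available to its neighbour, so
  -- the forward and backward totals F and B appear on both sides and cancel.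
  discharging n c periodic balanced = +-cancelʳ-≤ (F + B) D C (begin
    D + (F + B)                    ≡⟨ cong (D +_) (+-comm F B) ⟩
    D + (B + F)                    ≡⟨ split₃ (rotate demand) refl (rotate₂ send) ⟨
    ∑[ i < n ] spent (toℕ i)       ≤⟨ sum-mono-≤ {n} (λ i → balanced (toℕ i)) ⟩
    ∑[ i < n ] available (toℕ i)   ≡⟨ split₃ (rotate charge) refl (rotate₂ (λ a b → send b a)) ⟩
    C + (F + B)                    ∎)
    where
    open ≤-Reasoning
    spent available : ℕ → ℕ
    spent k     = demand (c (1 + k)) + (send (c (1 + k)) (c k) + send (c (1 + k)) (c (2 + k)))
    available k = charge (c (1 + k)) + (send (c k) (c (1 + k)) + send (c (2 + k)) (c (1 + k)))
    D C F B : ℕ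
    D = ∑[ i < n ] demand (c (toℕ i))
    C = ∑[ i < n ] charge (c (toℕ i))
    F = ∑[ i < n ] send (c (toℕ i)) (c (suc (toℕ i)))
    B = ∑[ i < n ] send (c (suc (toℕ i))) (c (toℕ i))
    split₃ : ∀ {f g h : Fin n → ℕ} {x y z} → sum f ≡ x → sum g ≡ y → sum h ≡ z →
             ∑[ i < n ] (f i + (g i + h i)) ≡ x + (y + z)
    split₃ {f} {g} {h} refl refl refl = trans (∑-distrib-+ f _) (cong (sum f +_) (∑-distrib-+ g h))
    rotate : (h : A → ℕ) → ∑[ i < n ] h (c (suc (toℕ i))) ≡ ∑[ i < n ] h (c (toℕ i))
    rotate h = sum-rotate n (λ k → h (c k)) (cong h (periodic 0))
    rotate₂ : (h : A → A → ℕ) → ∑[ i < n ] h (c (suc (toℕ i))) (c (suc (suc (toℕ i))))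
                                ≡ ∑[ i < n ] h (c (toℕ i)) (c (suc (toℕ i)))
    rotate₂ h = sum-rotate n (λ k → h (c k) (c (suc k))) (cong₂ h (periodic 0) (periodic 1))

adjacent≤1⇒2*sum≤n : ∀ n (z : ℕ → ℕ) → z n ≡ z 0 → (∀ k → z k + z (suc k) ≤ 1) →
                     2 * ∑[ i < n ] z (toℕ i) ≤ n
adjacent≤1⇒2*sum≤n n z zn≡z0 adjacent = begin
  2 * S                                       ≡⟨ cong (S +_) (+-identityʳ S) ⟩
  S + S                                       ≡⟨ cong (S +_) (sum-rotate n z zn≡z0) ⟨
  S + ∑[ i < n ] z (suc (toℕ i))              ≡⟨ ∑-distrib-+ {n} (z ∘ toℕ) (z ∘ suc ∘ toℕ) ⟨
  ∑[ i < n ] (z (toℕ i) + z (suc (toℕ i)))    ≤⟨ sum-mono-≤ {n} (adjacent ∘ toℕ) ⟩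
  ∑[ i < n ] 1                                ≡⟨ sum-const n 1 ⟩
  n * 1                                       ≡⟨ *-identityʳ n ⟩
  n                                           ∎
  where
  open ≤-Reasoning
  S : ℕ
  S = ∑[ i < n ] z (toℕ i)

CellOK : Label → List Label → Set
CellOK x ys = val x ≡ 0 → All (λ y → val y ≢ 0) ys × Any (λ y → val y ≡ 2) ys

cellOK? : ∀ x ys → Dec (CellOK x ys)
cellOK? x ys =
  val x ℕ.≟ 0 →-dec (All.all? (λ y → ¬? (val y ℕ.≟ 0)) ys ×-dec Any.any? (λ y → val y ℕ.≟ 2) ys)

module _ (G : Graph) (neighbours : Fin (Graph.N G) → List (Fin (Graph.N G)))
         (∈-neighbours⇔ : ∀ {u v} → v ∈ neighbours u ⇔ Graph.Adj G u v) where

  isOIRDF⇔cellOK : ∀ f → IsOIRDF G f ⇔ (∀ u → CellOK (f u) (map f (neighbours u)))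
  isOIRDF⇔cellOK f = mk⇔ local global
    where
    local : IsOIRDF G f → ∀ u → CellOK (f u) (map f (neighbours u))
    local O u fu≡0 =
        All.map⁺ (All.tabulate λ v∈ fv≡0 → independent u _ fu≡0 fv≡0 (to ∈-neighbours⇔ v∈))
      , (let (_ , adj , fv≡2) = dominated u fu≡0 in Any.map⁺ (lose (from ∈-neighbours⇔ adj) fv≡2))
      where open IsOIRDF O
    global : (∀ u → CellOK (f u) (map f (neighbours u))) → IsOIRDF G f
    global ok = record
      { dominated   = λ u fu≡0 → let (v , v∈ , fv≡2) = find (Any.map⁻ (proj₂ (ok u fu≡0))) in
                                 v , to ∈-neighbours⇔ v∈ , fv≡2
      ; independent = λ u v fu≡0 fv≡0 adj →
                        All.lookup (All.map⁻ (proj₁ (ok u fu≡0))) (from ∈-neighbours⇔ adj) fv≡0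
      }

[m+n%d]%d≡[m+n]%d : ∀ m n d .{{_ : NonZero d}} → (m + n % d) % d ≡ (m + n) % d
[m+n%d]%d≡[m+n]%d m n d = begin
  (m + n % d) % d            ≡⟨ %-distribˡ-+ m (n % d) d ⟩
  (m % d + n % d % d) % d    ≡⟨ cong (λ x → (m % d + x) % d) (m%n%n≡m%n n d) ⟩
  (m % d + n % d) % d        ≡⟨ %-distribˡ-+ m n d ⟨
  (m + n) % d                ∎
  where open ≡-Reasoning

module Cycle (m : ℕ) .{{_ : NonZero m}} where

  next prev : Fin m → Fin m
  next j = suc (toℕ j) mod m
  prev j = (toℕ j + pred m) mod m

  toℕ-mod : ∀ k → toℕ (k mod m) ≡ k % m
  toℕ-mod k = toℕ-fromℕ< (m%n<n k m)

  mod-cong : ∀ {k l} → k % m ≡ l % m → k mod m ≡ l mod m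
  mod-cong e = toℕ-injective (trans (toℕ-mod _) (trans e (sym (toℕ-mod _))))

  toℕ-mod-inverse : ∀ j → toℕ j mod m ≡ j
  toℕ-mod-inverse j = toℕ-injective (trans (toℕ-mod _) (m<n⇒m%n≡m (toℕ<n j)))

  +m-mod : ∀ k → (k + m) mod m ≡ k mod m
  +m-mod k = mod-cong ([m+n]%n≡m%n k m)

  next-mod : ∀ k → next (k mod m) ≡ suc k mod m
  next-mod k = mod-cong (trans (cong (λ x → suc x % m) (toℕ-mod k)) ([m+n%d]%d≡[m+n]%d 1 k m))

  suc[k+pred[m]]≡k+m : ∀ k → suc (k + pred m) ≡ k + m
  suc[k+pred[m]]≡k+m k = trans (sym (+-suc k (pred m))) (cong (k +_) (suc-pred m))

  prev-mod : ∀ k → prev (suc k mod m) ≡ k mod m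
  prev-mod k = mod-cong (begin
    (toℕ (suc k mod m) + pred m) % m   ≡⟨ cong (λ x → (x + pred m) % m) (toℕ-mod (suc k)) ⟩
    (suc k % m + pred m) % m           ≡⟨ cong (_% m) (+-comm (suc k % m) (pred m)) ⟩
    (pred m + suc k % m) % m           ≡⟨ [m+n%d]%d≡[m+n]%d (pred m) (suc k) m ⟩
    (pred m + suc k) % m               ≡⟨ cong (_% m) (trans (+-comm (pred m) (suc k)) (suc[k+pred[m]]≡k+m k)) ⟩
    (k + m) % m                        ≡⟨ [m+n]%n≡m%n k m ⟩
    k % m                              ∎)
    where open ≡-Reasoning

  prev-next : ∀ j → prev (next j) ≡ j
  prev-next j = trans (prev-mod (toℕ j)) (toℕ-mod-inverse j)

  next-prev : ∀ j → next (prev j) ≡ j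
  next-prev j = begin
    next ((toℕ j + pred m) mod m)   ≡⟨ next-mod (toℕ j + pred m) ⟩
    suc (toℕ j + pred m) mod m      ≡⟨ cong (_mod m) (suc[k+pred[m]]≡k+m (toℕ j)) ⟩
    (toℕ j + m) mod m               ≡⟨ +m-mod (toℕ j) ⟩
    toℕ j mod m                     ≡⟨ toℕ-mod-inverse j ⟩
    j                               ∎
    where open ≡-Reasoning

  toℕ-next : ∀ j → suc (toℕ j) ≡ toℕ (next j) ⊎ (suc (toℕ j) ≡ m × toℕ (next j) ≡ 0)
  toℕ-next j with m≤n⇒m<n∨m≡n (toℕ<n j)
  ... | inj₁ 1+j<m = inj₁ (sym (trans (toℕ-mod _) (m<n⇒m%n≡m 1+j<m)))
  ... | inj₂ 1+j≡m = inj₂ (1+j≡m , trans (toℕ-mod _) (trans (cong (_% m) 1+j≡m) (n%n≡0 m)))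

  Successor : Fin m → Fin m → Set
  Successor j j' = toℕ j + 1 ≡ toℕ j' ⊎ (toℕ j + 1 ≡ m × toℕ j' ≡ 0)

  successor⇔ : ∀ {j j'} → Successor j j' ⇔ j' ≡ next j
  successor⇔ {j} {j'} = mk⇔ unique (λ { refl → exists })
    where
    unique : Successor j j' → j' ≡ next j
    unique (inj₁ e) = trans (sym (toℕ-mod-inverse j')) (cong (_mod m) (trans (sym e) (+-comm (toℕ j) 1)))
    unique (inj₂ (e , z)) = toℕ-injective (begin
      toℕ j'            ≡⟨ z ⟩
      0                 ≡⟨ n%n≡0 m ⟨
      m % m             ≡⟨ cong (_% m) (trans (+-comm 1 (toℕ j)) e) ⟨
      suc (toℕ j) % m   ≡⟨ toℕ-mod (suc (toℕ j)) ⟨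
      toℕ (next j)      ∎)
      where open ≡-Reasoning
    exists : Successor j (next j)
    exists with toℕ-next j
    ... | inj₁ e       = inj₁ (trans (+-comm (toℕ j) 1) e)
    ... | inj₂ (e , z) = inj₂ (trans (+-comm (toℕ j) 1) e , z)

  cycAdj⇔ : ∀ {j j'} → CycAdj m j j' ⇔ (j' ≡ prev j ⊎ j' ≡ next j)
  cycAdj⇔ {j} {j'} = mk⇔ forward backward
    where
    predecessor : j ≡ next j' → j' ≡ prev j
    predecessor refl = sym (prev-next j')
    forward : CycAdj m j j' → j' ≡ prev j ⊎ j' ≡ next j
    forward (inj₁ e)                = inj₂ (to successor⇔ (inj₁ e))
    forward (inj₂ (inj₁ e))         = inj₁ (predecessor (to successor⇔ (inj₁ e)))
    forward (inj₂ (inj₂ (inj₁ e)))  = inj₂ (to successor⇔ (inj₂ e))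
    forward (inj₂ (inj₂ (inj₂ e)))  = inj₁ (predecessor (to successor⇔ (inj₂ e)))
    backward : j' ≡ prev j ⊎ j' ≡ next j → CycAdj m j j'
    backward (inj₁ refl) with from successor⇔ (sym (next-prev j))
    ... | inj₁ e = inj₂ (inj₁ e)
    ... | inj₂ e = inj₂ (inj₂ (inj₂ e))
    backward (inj₂ refl) with from successor⇔ refl
    ... | inj₁ e = inj₁ e
    ... | inj₂ e = inj₂ (inj₂ (inj₁ e))

pathAdj? : ∀ {n} (i i' : Fin n) → Dec (PathAdj n i i')
pathAdj? i i' = toℕ i + 1 ℕ.≟ toℕ i' ⊎-dec toℕ i' + 1 ℕ.≟ toℕ i

pathNeighbours : ∀ {n} → Fin n → List (Fin n)
pathNeighbours {n} i = filter (pathAdj? i) (allFin n)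

∈-pathNeighbours⇔ : ∀ {n} {i i' : Fin n} → i' ∈ pathNeighbours i ⇔ PathAdj n i i'
∈-pathNeighbours⇔ {i = i} {i'} =
  mk⇔ (λ i'∈ → proj₂ (∈-filter⁻ (pathAdj? i) {xs = allFin _} i'∈))
      (∈-filter⁺ (pathAdj? i) (∈-allFin i'))

module Grid (n m : ℕ) .{{_ : NonZero m}} where

  open Cycle m

  cellNeighbours : Fin n × Fin m → List (Fin n × Fin m)
  cellNeighbours (i , j) = (i , prev j) ∷ (i , next j) ∷ map (_, j) (pathNeighbours i)

  ∈-cellNeighbours⇔ : ∀ {p q} → q ∈ cellNeighbours p ⇔ PCAdj n m p q
  ∈-cellNeighbours⇔ {i , j} {q} = mk⇔ adjacent listed
    where
    adjacent : q ∈ cellNeighbours (i , j) → PCAdj n m (i , j) q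
    adjacent (here refl)         = inj₁ (refl , from cycAdj⇔ (inj₁ refl))
    adjacent (there (here refl)) = inj₁ (refl , from cycAdj⇔ (inj₂ refl))
    adjacent (there (there q∈)) with ∈-map⁻ (_, j) q∈
    ... | i' , i'∈ , refl = inj₂ (refl , to ∈-pathNeighbours⇔ i'∈)
    listed : PCAdj n m (i , j) q → q ∈ cellNeighbours (i , j)
    listed (inj₁ (refl , adj)) with to cycAdj⇔ adj
    ... | inj₁ refl = here refl
    ... | inj₂ refl = there (here refl)
    listed (inj₂ (refl , adj)) = there (there (∈-map⁺ (_, j) (from ∈-pathNeighbours⇔ adj)))

  vertexNeighbours : Fin (n * m) → List (Fin (n * m))
  vertexNeighbours u = map (uncurry combine) (cellNeighbours (remQuot m u))

  ∈-vertexNeighbours⇔ : ∀ {u v} → v ∈ vertexNeighbours u ⇔ Graph.Adj (P□C n m) u v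
  ∈-vertexNeighbours⇔ {u} {v} = mk⇔ (to ∈-cellNeighbours⇔ ∘ decode) (encode ∘ from ∈-cellNeighbours⇔)
    where
    decode : v ∈ vertexNeighbours u → remQuot m v ∈ cellNeighbours (remQuot m u)
    decode v∈ with ∈-map⁻ (uncurry combine) v∈
    ... | (i , j) , ij∈ , refl = subst (_∈ _) (sym (remQuot-combine i j)) ij∈
    encode : remQuot m v ∈ cellNeighbours (remQuot m u) → v ∈ vertexNeighbours u
    encode ij∈ = subst (_∈ _) (combine-remQuot {n} m v) (∈-map⁺ (uncurry combine) ij∈)

-- Columns of P₃ □ Cₘ

Col : Set
Col = Label × Label × Label

row : Col → Fin 3 → Label
row (x , y , z) 0F = x
row (x , y , z) 1F = y
row (x , y , z) 2F = z

colWeight : Col → ℕ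
colWeight b = ∑[ r < 3 ] val (row b r)

ColumnOK : Col → Col → Col → Set
ColumnOK (a₀ , a₁ , a₂) (b₀ , b₁ , b₂) (c₀ , c₁ , c₂) =
    CellOK b₀ (a₀ ∷ c₀ ∷ b₁ ∷ [])
  × CellOK b₁ (a₁ ∷ c₁ ∷ b₀ ∷ b₂ ∷ [])
  × CellOK b₂ (a₂ ∷ c₂ ∷ b₁ ∷ [])

columnOK? : ∀ a b c → Dec (ColumnOK a b c)
columnOK? a b c = cellOK? _ _ ×-dec cellOK? _ _ ×-dec cellOK? _ _

module Columns (m : ℕ) .{{_ : NonZero m}} where

  open Cycle m
  open Grid 3 m

  column : (Fin (3 * m) → Label) → Fin m → Col
  column f j = f (combine {3} 0F j) , f (combine {3} 1F j) , f (combine {3} 2F j)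

  isOIRDF⇔columnOK : ∀ f → IsOIRDF (P□C 3 m) f ⇔
                     (∀ j → ColumnOK (column f (prev j)) (column f j) (column f (next j)))
  isOIRDF⇔columnOK f = mk⇔ (λ O j → columnOK j (to cellwise O)) (λ ok → from cellwise (cellOK ok))
    where
    CellOKAt : Fin (3 * m) → Set
    CellOKAt u = CellOK (f u) (map f (vertexNeighbours u))
    cellwise : IsOIRDF (P□C 3 m) f ⇔ (∀ u → CellOKAt u)
    cellwise = isOIRDF⇔cellOK (P□C 3 m) vertexNeighbours ∈-vertexNeighbours⇔ f
    atCombine : ∀ (r : Fin 3) j → CellOKAt (combine r j) ≡
                        CellOK (f (combine r j)) (map f (map (uncurry combine) (cellNeighbours (r , j))))
    atCombine r j = cong (λ p → CellOK (f (combine r j)) (map f (map (uncurry combine) (cellNeighbours p))))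
                         (remQuot-combine r j)
    columnOK : ∀ j → (∀ u → CellOKAt u) → ColumnOK (column f (prev j)) (column f j) (column f (next j))
    -- For a concrete row r the filtered list of vertical neighbours computes,
    -- so each `at r` already has the type of the corresponding part of ColumnOK.
    columnOK j ok = at 0F , at 1F , at 2F
      where
      at : ∀ (r : Fin 3) → CellOK (f (combine r j)) (map f (map (uncurry combine) (cellNeighbours (r , j))))
      at r = subst id (atCombine r j) (ok (combine r j))
    cellOK : (∀ j → ColumnOK (column f (prev j)) (column f j) (column f (next j))) → ∀ u → CellOKAt u
    cellOK ok u = subst CellOKAt (combine-remQuot {3} m u) (at (proj₁ (remQuot m u)) (proj₂ (remQuot m u)))
      where
      at : ∀ (r : Fin 3) j → CellOKAt (combine r j)
      at 0F j = subst id (sym (atCombine 0F j)) (proj₁ (ok j))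
      at 1F j = subst id (sym (atCombine 1F j)) (proj₁ (proj₂ (ok j)))
      at 2F j = subst id (sym (atCombine 2F j)) (proj₂ (proj₂ (ok j)))

  weight≡∑colWeight : ∀ f → weight (P□C 3 m) f ≡ ∑[ j < m ] colWeight (column f j)
  weight≡∑colWeight f = begin
    sumFin (3 * m) (λ v → val (f v))               ≡⟨ sumFin≡sum (3 * m) _ ⟩
    sum (λ v → val (f v))                          ≡⟨ sum-combine 3 m (λ v → val (f v)) ⟩
    ∑[ r < 3 ] ∑[ j < m ] val (f (combine r j))    ≡⟨ ∑-comm {3} {m} (λ r j → val (f (combine r j))) ⟩
    ∑[ j < m ] ∑[ r < 3 ] val (f (combine r j))    ∎
    where open ≡-Reasoning

-- The discharging rules

isZero : Label → ℕ
isZero 0F      = 1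
isZero (suc _) = 0

twos : Label → ℕ
twos 2F = 1
twos _  = 0

charge : Col → ℕ
charge b = 8 * colWeight b + 4 * isZero (row b 1F)

send : Col → Col → ℕ
send (x , _ , z) (0F , 1F , 0F) = 1 + 4 * (twos x + twos z)
send _           (0F , 2F , 0F) = 1
send (2F , _ , _) (0F , 1F , 1F) = 2
send (_ , _ , 2F) (1F , 1F , 0F) = 2
send _ _ = 0

open Discharging (λ _ → 18) charge send

allCol? : {P : Col → Set} → (∀ c → Dec (P c)) → Dec (∀ c → P c)
allCol? P? = map′ (λ h (x , y , z) → h x y z) (λ h x y z → h (x , y , z))
                  (all? λ x → all? λ y → all? λ z → P? (x , y , z))

balanced? : ∀ a b c → Dec (Balanced a b c)
balanced? a b c = _ ≤? _

balanced : ∀ a b c → ColumnOK a b c → Balanced a b c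
balanced = from-yes (allCol? λ a → allCol? λ b → allCol? λ c → columnOK? a b c →-dec balanced? a b c)

middleZeros-apart : ∀ a b c → ColumnOK a b c → isZero (row a 1F) + isZero (row b 1F) ≤ 1
middleZeros-apart (_ , 0F    , _) (_ , 0F    , _) _ (_ , ok₁ , _) with proj₁ (ok₁ refl)
... | a₁≢0 ∷ _ = ⊥-elim (a₁≢0 refl)
middleZeros-apart (_ , 0F    , _) (_ , suc _ , _) _ _ = s≤s z≤n
middleZeros-apart (_ , suc _ , _) (_ , 0F    , _) _ _ = s≤s z≤n
middleZeros-apart (_ , suc _ , _) (_ , suc _ , _) _ _ = z≤n

-- Lower bound

2*z≤odd⇒2*z+1≤odd : ∀ {z m} → m % 2 ≡ 1 → 2 * z ≤ m → 2 * z + 1 ≤ m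
2*z≤odd⇒2*z+1≤odd {z} {m} odd 2z≤m = subst (_≤ m) (+-comm 1 (2 * z)) (≤∧≢⇒< 2z≤m 2z≢m)
  where
  2z≢m : 2 * z ≢ m
  2z≢m refl = 0≢1+n (trans (sym (trans (cong (_% 2) (*-comm 2 z)) (m*n%n≡0 z 2))) odd)

module LowerBound (m : ℕ) .{{_ : NonZero m}} (f : Fin (3 * m) → Label) (O : IsOIRDF (P□C 3 m) f) where

  open Cycle m
  open Columns m

  columns : ℕ → Col
  columns k = column f (k mod m)

  columns-periodic : Periodic m columns
  columns-periodic k = cong (column f) (+m-mod k)

  columns-ok : ∀ k → ColumnOK (columns k) (columns (suc k)) (columns (suc (suc k)))
  columns-ok k = subst₂ (λ p q → ColumnOK (column f p) (columns (suc k)) (column f q))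
                        (prev-mod k) (next-mod (suc k)) (to (isOIRDF⇔columnOK f) O (suc k mod m))

  ∑columns : ∀ (g : Col → ℕ) → ∑[ i < m ] g (columns (toℕ i)) ≡ ∑[ j < m ] g (column f j)
  ∑columns g = sum-cong-≗ (λ j → cong (g ∘ column f) (toℕ-mod-inverse j))

  middleZeros : ℕ
  middleZeros = ∑[ j < m ] isZero (f (combine {3} 1F j))

  charge-bound : 18 * m ≤ 8 * weight (P□C 3 m) f + 4 * middleZeros
  charge-bound = begin
    18 * m                                        ≡⟨ *-comm 18 m ⟩
    m * 18                                        ≡⟨ sum-const m 18 ⟨
    ∑[ i < m ] 18                                 ≤⟨ discharging m columns columns-periodic
                                                       (λ k → balanced _ _ _ (columns-ok k)) ⟩
    ∑[ i < m ] charge (columns (toℕ i))           ≡⟨ ∑columns charge ⟩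
    ∑[ j < m ] charge (column f j)                ≡⟨ ∑-distrib-+ {m} (λ j → 8 * colWeight (column f j)) _ ⟩
    ∑[ j < m ] (8 * colWeight (column f j)) + ∑[ j < m ] (4 * isZero (f (combine {3} 1F j)))
      ≡⟨ cong₂ _+_ (*-distribˡ-sum {m} 8 (colWeight ∘ column f))
                   (*-distribˡ-sum {m} 4 (λ j → isZero (f (combine {3} 1F j)))) ⟨
    8 * ∑[ j < m ] colWeight (column f j) + 4 * middleZeros
      ≡⟨ cong (λ w → 8 * w + 4 * middleZeros) (weight≡∑colWeight f) ⟨
    8 * weight (P□C 3 m) f + 4 * middleZeros      ∎
    where open ≤-Reasoning

  middleZeros-bound : 2 * middleZeros ≤ m
  middleZeros-bound = subst (λ s → 2 * s ≤ m) (∑columns middleZero)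
    (adjacent≤1⇒2*sum≤n m (middleZero ∘ columns) (cong middleZero (columns-periodic 0))
                         (λ k → middleZeros-apart _ _ _ (columns-ok k)))
    where
    middleZero : Col → ℕ
    middleZero b = isZero (row b 1F)

  weight-bound : ∀ d → 2 * middleZeros + d ≤ m → 2 * d + 8 * (2 * m) ≤ 8 * weight (P□C 3 m) f
  weight-bound d zeros = +-cancelʳ-≤ (2 * m) _ _ (begin
    2 * d + 8 * (2 * m) + 2 * m     ≡⟨ regroupˡ m d ⟩
    18 * m + 2 * d                  ≤⟨ +-monoˡ-≤ (2 * d) charge-bound ⟩
    8 * W + 4 * middleZeros + 2 * d ≡⟨ regroupʳ W middleZeros d ⟩
    8 * W + 2 * (2 * middleZeros + d)
                                    ≤⟨ +-monoʳ-≤ (8 * W) (*-monoʳ-≤ 2 zeros) ⟩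
    8 * W + 2 * m                   ∎)
    where
    open ≤-Reasoning
    W : ℕ
    W = weight (P□C 3 m) f
    regroupˡ : ∀ m d → 2 * d + 8 * (2 * m) + 2 * m ≡ 18 * m + 2 * d
    regroupˡ = solve-∀
    regroupʳ : ∀ w z d → 8 * w + 4 * z + 2 * d ≡ 8 * w + 2 * (2 * z + d)
    regroupʳ = solve-∀

  weight-lower : 2 * m ≤ weight (P□C 3 m) f
  weight-lower = *-cancelˡ-≤ 8 (weight-bound 0 (subst (_≤ m) (sym (+-identityʳ _)) middleZeros-bound))

  weight-lower-odd : m % 2 ≡ 1 → 2 * m + 1 ≤ weight (P□C 3 m) f
  weight-lower-odd odd = subst (_≤ weight (P□C 3 m) f) (+-comm 1 (2 * m)) (*-cancelˡ-< 8 (2 * m) _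
    (≤-trans (n≤1+n _) (weight-bound 1 (2*z≤odd⇒2*z+1≤odd {middleZeros} odd middleZeros-bound))))

-- Upper bound

alternating : ℕ → Col
alternating 0             = 1F , 0F , 1F
alternating 1             = 0F , 2F , 0F
alternating (suc (suc k)) = alternating k

alternating-ok : ∀ k → ColumnOK (alternating k) (alternating (1 + k)) (alternating (2 + k))
alternating-ok 0             = from-yes (columnOK? (alternating 0) (alternating 1) (alternating 2))
alternating-ok 1             = from-yes (columnOK? (alternating 1) (alternating 2) (alternating 3))
alternating-ok (suc (suc k)) = alternating-ok k

alternating-weight : ∀ k → colWeight (alternating k) ≡ 2
alternating-weight 0             = refl
alternating-weight 1             = refl
alternating-weight (suc (suc k)) = alternating-weight k

alternating-mod2 : ∀ k → alternating k ≡ alternating (k % 2)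
alternating-mod2 0             = refl
alternating-mod2 1             = refl
alternating-mod2 (suc (suc k)) =
  trans (alternating-mod2 k) (cong alternating (sym (trans (cong (_% 2) (+-comm 2 k)) ([m+n]%n≡m%n k 2))))

alternating-suc₀ : ∀ k → alternating k ≡ alternating 0 → alternating (suc k) ≡ alternating 1
alternating-suc₀ 0             _ = refl
alternating-suc₀ 1             ()
alternating-suc₀ (suc (suc k)) e = alternating-suc₀ k e

alternating-suc₁ : ∀ k → alternating k ≡ alternating 1 → alternating (suc k) ≡ alternating 0
alternating-suc₁ 0             ()
alternating-suc₁ 1             _ = refl
alternating-suc₁ (suc (suc k)) e = alternating-suc₁ k e

oddWord : ℕ → Col
oddWord 0       = 1F , 1F , 1F
oddWord (suc k) = alternating (suc k)

oddWord-weight : ∀ n → ∑[ j < suc n ] colWeight (oddWord (toℕ j)) ≡ 2 * suc n + 1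
oddWord-weight n = begin
  3 + ∑[ j < n ] colWeight (alternating (suc (toℕ j)))
                      ≡⟨ cong (3 +_) (sum-cong-≗ {n} (alternating-weight ∘ suc ∘ toℕ)) ⟩
  3 + ∑[ j < n ] 2    ≡⟨ cong (3 +_) (sum-const n 2) ⟩
  3 + n * 2           ≡⟨ regroup n ⟩
  2 * suc n + 1       ∎
  where
  open ≡-Reasoning
  regroup : ∀ n → 3 + n * 2 ≡ 2 * suc n + 1
  regroup = solve-∀

module UpperBound (m : ℕ) .{{_ : NonZero m}} where

  open Cycle m
  open Columns m

  fromColumns : (Fin m → Col) → Fin (3 * m) → Label
  fromColumns h v = row (h (proj₂ (remQuot {3} m v))) (proj₁ (remQuot {3} m v))

  column-fromColumns : ∀ h j → column (fromColumns h) j ≡ h j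
  column-fromColumns h j = cong₂ _,_ (at 0F) (cong₂ _,_ (at 1F) (at 2F))
    where
    at : ∀ (r : Fin 3) → fromColumns h (combine r j) ≡ row (h j) r
    at r = cong (λ p → row (h (proj₂ p)) (proj₁ p)) (remQuot-combine r j)

  cyclic-triples : ∀ {A : Set} (P : A → A → A → Set) (w : ℕ → A) → 2 ≤ m →
               (∀ r → 2 + r < m → P (w r) (w (1 + r)) (w (2 + r))) →
               (∀ r → 2 + r ≡ m → P (w r) (w (1 + r)) (w 0)) →
               (∀ r → 1 + r ≡ m → P (w r) (w 0) (w 1)) →
               ∀ j → P (w (toℕ (prev j))) (w (toℕ j)) (w (toℕ (next j)))
  cyclic-triples P w 2≤m interior wrap₁ wrap₂ j =
    subst (λ i → P (w (toℕ (prev j))) (w (toℕ i)) (w (toℕ (next i)))) (next-prev j) (around (prev j))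
    where
    P-at : ∀ {x x' y y' z z'} → x ≡ x' → y ≡ y' → z ≡ z' →
           P (w x) (w y) (w z) → P (w x') (w y') (w z')
    P-at = subst₃ (λ x y z → P (w x) (w y) (w z))
    around : ∀ i → P (w (toℕ i)) (w (toℕ (next i))) (w (toℕ (next (next i))))
    around i with toℕ-next i | toℕ-next (next i)
    ... | inj₁ e₁ | inj₁ e₂ = P-at refl e₁ e₁₂ (interior _ (subst (_< m) (sym e₁₂) (toℕ<n (next (next i)))))
      where
      e₁₂ : suc (suc (toℕ i)) ≡ toℕ (next (next i))
      e₁₂ = trans (cong suc e₁) e₂
    ... | inj₁ e₁ | inj₂ (e₂ , z₂) = P-at refl e₁ (sym z₂) (wrap₁ _ (trans (cong suc e₁) e₂))
    ... | inj₂ (e₁ , z₁) | inj₁ e₂ = P-at refl (sym z₁) (trans (sym (cong suc z₁)) e₂) (wrap₂ _ e₁)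
    ... | inj₂ (_ , z₁) | inj₂ (e₂ , _) with subst (2 ≤_) (trans (sym e₂) (cong suc z₁)) 2≤m
    ...   | s≤s ()

  fromColumns-OIRDF : ∀ h → (∀ j → ColumnOK (h (prev j)) (h j) (h (next j))) →
                      IsOIRDF (P□C 3 m) (fromColumns h)
  fromColumns-OIRDF h ok = from (isOIRDF⇔columnOK (fromColumns h)) λ j →
    subst₃ ColumnOK (sym (column-fromColumns h (prev j))) (sym (column-fromColumns h j))
                    (sym (column-fromColumns h (next j))) (ok j)

  fromColumns-weight : ∀ h → weight (P□C 3 m) (fromColumns h) ≡ ∑[ j < m ] colWeight (h j)
  fromColumns-weight h = trans (weight≡∑colWeight _) (sum-cong-≗ (cong colWeight ∘ column-fromColumns h))

  even-OIRDF : 2 ≤ m → m % 2 ≡ 0 →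
               Σ (Fin (3 * m) → Label) λ f → IsOIRDF (P□C 3 m) f × weight (P□C 3 m) f ≡ 2 * m
  even-OIRDF 2≤m even = fromColumns h , fromColumns-OIRDF h ok , trans (fromColumns-weight h) total
    where
    h : Fin m → Col
    h j = alternating (toℕ j)
    period : alternating m ≡ alternating 0
    period = trans (alternating-mod2 m) (cong alternating even)
    wrap₁ : ∀ r → 2 + r ≡ m → ColumnOK (alternating r) (alternating (1 + r)) (alternating 0)
    wrap₁ r refl = subst (ColumnOK _ _) period (alternating-ok r)
    wrap₂ : ∀ r → 1 + r ≡ m → ColumnOK (alternating r) (alternating 0) (alternating 1)
    wrap₂ r refl = subst₂ (ColumnOK _) period (alternating-suc₀ m period) (alternating-ok r)
    ok : ∀ j → ColumnOK (h (prev j)) (h j) (h (next j))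
    ok = cyclic-triples ColumnOK alternating 2≤m (λ r _ → alternating-ok r) wrap₁ wrap₂
    total : ∑[ j < m ] colWeight (h j) ≡ 2 * m
    total = trans (sum-cong-≗ {m} (alternating-weight ∘ toℕ)) (trans (sum-const m 2) (*-comm m 2))

  odd-OIRDF : 3 ≤ m → m % 2 ≡ 1 →
              Σ (Fin (3 * m) → Label) λ f → IsOIRDF (P□C 3 m) f × weight (P□C 3 m) f ≡ 2 * m + 1
  odd-OIRDF 3≤m odd = fromColumns h , fromColumns-OIRDF h ok , trans (fromColumns-weight h) total
    where
    h : Fin m → Col
    h j = oddWord (toℕ j)
    period : alternating m ≡ alternating 1
    period = trans (alternating-mod2 m) (cong alternating odd)
    interior : ∀ r → 2 + r < m → ColumnOK (oddWord r) (oddWord (1 + r)) (oddWord (2 + r))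
    interior 0       _ = from-yes (columnOK? (oddWord 0) (oddWord 1) (oddWord 2))
    interior (suc r) _ = alternating-ok (suc r)
    wrap₁ : ∀ r → 2 + r ≡ m → ColumnOK (oddWord r) (oddWord (1 + r)) (oddWord 0)
    wrap₁ 0       e    = ⊥-elim (<⇒≱ ≤-refl (subst (3 ≤_) (sym e) 3≤m))
    wrap₁ (suc r) refl = subst₃ ColumnOK (sym period) (sym (alternating-suc₁ (suc r) period)) refl
                                (from-yes (columnOK? (alternating 1) (alternating 0) (oddWord 0)))
    wrap₂ : ∀ r → 1 + r ≡ m → ColumnOK (oddWord r) (oddWord 0) (oddWord 1)
    wrap₂ 0       e    = ⊥-elim (<⇒≱ (s≤s (s≤s z≤n)) (subst (3 ≤_) (sym e) 3≤m))
    wrap₂ (suc r) refl = subst₃ ColumnOK (sym (alternating-suc₁ r period)) refl refl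
                                (from-yes (columnOK? (alternating 0) (oddWord 0) (oddWord 1)))
    ok : ∀ j → ColumnOK (h (prev j)) (h j) (h (next j))
    ok = cyclic-triples ColumnOK oddWord (≤-trans (n≤1+n 2) 3≤m) interior wrap₁ wrap₂
    total : ∑[ j < m ] colWeight (h j) ≡ 2 * m + 1
    total = subst (λ k → ∑[ j < k ] colWeight (oddWord (toℕ j)) ≡ 2 * k + 1) (suc-pred m)
                  (oddWord-weight (pred m))

theorem3 : (m : ℕ) → 3 ≤ m →
    (m % 2 ≡ 0 → γoiR≡ (P□C 3 m) (2 * m))
    × (m % 2 ≡ 1 → γoiR≡ (P□C 3 m) (2 * m + 1))
theorem3 m@(suc _) 3≤m =
    (λ even → even-OIRDF (≤-trans (n≤1+n 2) 3≤m) even , λ f O → LowerBound.weight-lower m f O)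
  , (λ odd  → odd-OIRDF 3≤m odd , λ f O → LowerBound.weight-lower-odd m f O odd)
  where open UpperBound m
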